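{- Let $\mathcal K$ be a Fraïssé class (of finite structures in a countable relational language) and let $\mathbf K=\mathrm{Flim}(\mathcal K)$ be an enumerated Fraïssé limit (underlying set $\omega$). If every enumerated $\mathbf A\in\mathcal K$ has finite ordered Ramsey degree in $\mathbf K$, then $\mathcal K$ has finite big Ramsey degrees. If moreover $\mathcal K$ is a strong amalgamation class, then the converse also holds: $\mathcal K$ has finite big Ramsey degrees if and only if every enumerated $\mathbf A\in\mathcal K$ has finite ordered Ramsey degree in $\mathbf K$.
   Context: An enumerated structure is a structure whose underlying set is the cardinal $|\mathbf A|$ (here always countable). For enumerated $\mathbf A,\mathbf K$, an ordered embedding is an embedding of $\langle\mathbf A,<\rangle$ into $\langle\mathbf K,<\rangle$, where $<$ is the usual order on ordinals; $\mathrm{OEmb}(\mathbf A,\mathbf K)$ is the set of these. For an infinite structure $\mathbf K$ and finite $\mathbf A$ with $\mathrm{Emb}(\mathbf A,\mathbf K)\ne\emptyset$, the Ramsey degree of $\mathbf A$ in $\mathbf K$ is the least $\ell<\omega$ such that for every $r<\omega$ and every $\chi:\mathrm{Emb}(\mathbf A,\mathbf K)\to r$ there is $\eta\in\mathrm{Emb}(\mathbf K,\mathbf K)$ with $|\{\chi(\eta\circ f):f\in\mathrm{Emb}(\mathbf A,\mathbf K)\}|\le \ell$. The ordered Ramsey degree of $\mathbf A$ in $\mathbf K$ is the Ramsey degree of $\langle\mathbf A,<\rangle$ in $\langle\mathbf K,<\rangle$ (i.e. the same definition with $\mathrm{OEmb}$ in place of $\mathrm{Emb}$ throughout). The big Ramsey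 degree of $\mathbf A\in\mathcal K$ is its Ramsey degree in $\mathrm{Flim}(\mathcal K)$, and $\mathcal K$ has finite big Ramsey degrees if every $\mathbf A\in\mathcal K$ has finite big Ramsey degree. A Fraïssé class is a strong amalgamation class if any two embeddings $f:\mathbf A\to\mathbf B$, $g:\mathbf A\to\mathbf C$ in $\mathcal K$ can be amalgamated by embeddings $r:\mathbf B\to\mathbf D$, $s:\mathbf C\to\mathbf D$ in $\mathcal K$ with $r\circ f=s\circ g$, $\mathbf D=\mathrm{im}(r)\cup\mathrm{im}(s)$ and $\mathrm{im}(r)\cap\mathrm{im}(s)=\mathrm{im}(r\circ f)$. -}

module Defs where

open import Data.Nat using (ℕ; _<_)
open import Data.Fin using (Fin; toℕ)
open import Data.Vec using (Vec)
import Data.Vec as Vec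
open import Data.Vec.Properties using (map-∘)
open import Data.Bool using (Bool)
open import Data.Product using (Σ; ∃; _×_; _,_; proj₁; proj₂)
open import Data.Sum using (_⊎_)
open import Function using (_∘_)
open import Function.Bundles using (_⇔_)
open import Relation.Binary.PropositionalEquality

record Lang : Set₁ where
  field
    Sym      : Set
    arity    : Sym → ℕ
    -- countability: an injective coding of the symbols by naturals
    code     : Sym → ℕ
    code-inj : ∀ {s t} → code s ≡ code t → s ≡ t

open Lang public

-- An L-structure on carrier C: each symbol s interpreted as a relation of
-- arity (arity s) on C (classically every relation is decidable, so Bool).
record Str (L : Lang) (C : Set) : Set where
  constructor mkStr
  field
    rel : (s : Sym L) → Vec C (arity L s) → Bool

open Str public

record Emb {L : Lang} {C D : Set} (A : Str L C) (B : Str L D) : Set where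
  field
    fun  : C → D
    inj  : ∀ {x y} → fun x ≡ fun y → x ≡ y
    pres : ∀ s (v : Vec C (arity L s)) → rel B s (Vec.map fun v) ≡ rel A s v

open Emb public

_∘E_ : ∀ {L C D E} {A : Str L C} {B : Str L D} {F : Str L E} →
       Emb B F → Emb A B → Emb A F
_∘E_ {A = A} {B} {F} g f = record
  { fun  = fun g ∘ fun f
  ; inj  = λ eq → inj f (inj g eq)
  ; pres = λ s v → trans (cong (rel F s) (map-∘ (fun g) (fun f) v))
                         (trans (pres g s (Vec.map (fun f) v)) (pres f s v))
  }

Iso : ∀ {L C D} → Str L C → Str L D → Set
Iso A B = Σ (Emb A B) λ e → ∀ y → ∃ λ x → fun e x ≡ y

-- Enumerated finite structures (underlying set the cardinal n = Fin n)

FinStr : Lang → Set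
FinStr L = Σ ℕ λ n → Str L (Fin n)

size : ∀ {L} → FinStr L → ℕ
size = proj₁

str : ∀ {L} (A : FinStr L) → Str L (Fin (size A))
str = proj₂

EmbF : ∀ {L} → FinStr L → FinStr L → Set
EmbF A B = Emb (str A) (str B)

IsoF : ∀ {L} → FinStr L → FinStr L → Set
IsoF A B = Iso (str A) (str B)

Class : Lang → Set₁
Class L = FinStr L → Set

record IsFraisseClass {L : Lang} (𝒦 : Class L) : Set where
  field
    iso-closed   : ∀ A B → IsoF A B → 𝒦 A → 𝒦 B
    hereditary   : ∀ A B → EmbF A B → 𝒦 B → 𝒦 A
    joint-emb    : ∀ A B → 𝒦 A → 𝒦 B →
                   Σ (FinStr L) λ C → 𝒦 C × EmbF A C × EmbF B C
    amalgamation : ∀ A B C (f : EmbF A B) (g : EmbF A C) →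
                   𝒦 A → 𝒦 B → 𝒦 C →
                   Σ (FinStr L) λ D → 𝒦 D × Σ (EmbF B D) λ r → Σ (EmbF C D) λ s →
                     ∀ x → fun r (fun f x) ≡ fun s (fun g x)
    countable    : Σ (ℕ → FinStr L) λ e → ∀ A → 𝒦 A → ∃ λ k → IsoF A (e k)

IsStrongAmalgamationClass : ∀ {L} → Class L → Set
IsStrongAmalgamationClass {L} 𝒦 =
  IsFraisseClass 𝒦 ×
  (∀ A B C (f : EmbF A B) (g : EmbF A C) → 𝒦 A → 𝒦 B → 𝒦 C →
     Σ (FinStr L) λ D → 𝒦 D × Σ (EmbF B D) λ r → Σ (EmbF C D) λ s →
       (∀ x → fun r (fun f x) ≡ fun s (fun g x)) ×
       (∀ d → (∃ λ b → fun r b ≡ d) ⊎ (∃ λ c → fun s c ≡ d)) ×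
       (∀ b c → fun r b ≡ fun s c → ∃ λ a → fun r (fun f a) ≡ fun r b))

IsFlim : ∀ {L} → Class L → Str L ℕ → Set
IsFlim {L} 𝒦 K =
  (∀ (A : FinStr L) → 𝒦 A ⇔ Emb (str A) K) ×
  (∀ (A : FinStr L) (f g : Emb (str A) K) →
     Σ (Iso K K) λ σ → ∀ x → fun (proj₁ σ) (fun f x) ≡ fun g x)

-- colourings of a set of embeddings (regarded as a set of maps):
-- they only depend on the underlying map
Extensional : ∀ {L C D} {A : Str L C} {B : Str L D} {E X : Set} →
              (E → Emb A B) → (E → X) → Set
Extensional u χ = ∀ f g → (∀ x → fun (u f) x ≡ fun (u g) x) → χ f ≡ χ g

RamseyBound : ∀ {L} (A : FinStr L) (K : Str L ℕ) → ℕ → Set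
RamseyBound A K ℓ =
  ∀ (r : ℕ) (χ : Emb (str A) K → Fin r) → Extensional (λ f → f) χ →
  Σ (Emb K K) λ η → Σ (Fin ℓ → Fin r) λ cs →
    ∀ (f : Emb (str A) K) → ∃ λ i → χ (η ∘E f) ≡ cs i

HasFiniteRamseyDegree : ∀ {L} (A : FinStr L) (K : Str L ℕ) → Set
HasFiniteRamseyDegree A K = ∃ λ ℓ → RamseyBound A K ℓ

IsOrdered : ∀ {L C D} {A : Str L C} {B : Str L D} →
            (C → ℕ) → (D → ℕ) → Emb A B → Set
IsOrdered ρC ρD e = ∀ x y → ρC x < ρC y → ρD (fun e x) < ρD (fun e y)

OEmbF : ∀ {L} (A : FinStr L) (K : Str L ℕ) → Set
OEmbF A K = Σ (Emb (str A) K) (IsOrdered toℕ (λ n → n))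

OEmbK : ∀ {L} (K : Str L ℕ) → Set
OEmbK K = Σ (Emb K K) (IsOrdered (λ n → n) (λ n → n))

_∘O_ : ∀ {L} {A : FinStr L} {K : Str L ℕ} → OEmbK K → OEmbF A K → OEmbF A K
(η , oη) ∘O (f , of) = η ∘E f , λ x y x<y → oη _ _ (of x y x<y)

OrderedRamseyBound : ∀ {L} (A : FinStr L) (K : Str L ℕ) → ℕ → Set
OrderedRamseyBound A K ℓ =
  ∀ (r : ℕ) (χ : OEmbF A K → Fin r) → Extensional proj₁ χ →
  Σ (OEmbK K) λ η → Σ (Fin ℓ → Fin r) λ cs →
    ∀ (f : OEmbF A K) → ∃ λ i → χ (η ∘O f) ≡ cs i

HasFiniteOrderedRamseyDegree : ∀ {L} (A : FinStr L) (K : Str L ℕ) → Set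
HasFiniteOrderedRamseyDegree A K = ∃ λ ℓ → OrderedRamseyBound A K ℓ

HasFiniteBigRamseyDegrees : ∀ {L} → Class L → Str L ℕ → Set
HasFiniteBigRamseyDegrees 𝒦 K = ∀ A → 𝒦 A → HasFiniteRamseyDegree A K

AllFiniteOrderedDegrees : ∀ {L} → Class L → Str L ℕ → Set
AllFiniteOrderedDegrees 𝒦 K = ∀ A → 𝒦 A → HasFiniteOrderedRamseyDegree A K

module Submission where

-- An embedding f of an n-element structure A into K
-- induces a linear order on A; sorting the points of A by their images
-- (`Sorting`) writes f as an *ordered* embedding of a reordered copy of A,
-- composed with the reordering.  There are only finitely many reorderings
-- (`reorderings`: pairs of mutually inverse tables on Fin n), each
-- reordered copy lies in 𝒦, and ordered Ramsey bounds for finitely many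
-- structures are realised simultaneously by one ordered η
-- (`simultaneous`); the palettes add up (`Forward.bigRamseyBound`).
--
-- Given a big Ramsey bound for A, colour the
-- non-ordered embeddings of A with one extra colour (`ExtendedColouring`).
-- The resulting η need not be ordered, but there is θ : K → K with η ∘ θ
-- increasing (`Straighten`): the prefixes of K are embedded one point at a
-- time (`IncreasingChain`), and strong amalgamation provides arbitrarily
-- many extensions with distinct new points, so one lands above any bound
-- (`OnePointExtension.farExtension`).  The same construction yields an
-- ordered embedding of A (`orderedEmbedding`), whose colour replaces the
-- extra one (`orderedBound`).

open import Defs
open import Data.Nat as ℕ using (ℕ; zero; suc; _+_; _<_; _≤_; _⊔_; z≤n; s≤s)
import Data.Nat.Properties as ℕP
open import Data.Nat.ListAction using (sum)
open import Data.Fin as Fin using (Fin; toℕ; fromℕ; fromℕ<; inject₁; splitAt; _↑ˡ_; _↑ʳ_; punchOut)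
import Data.Fin.Properties as FinP
open import Data.Fin.Induction using (>-weakInduction)
open import Data.Vec as Vec using (Vec)
import Data.Vec.Properties as VecP
open import Data.List as List using (List; []; _∷_)
open import Data.List.Relation.Unary.All as All using (All; []; _∷_)
open import Data.List.Relation.Unary.Any as Any using (Any; here; there)
import Data.List.Membership.Propositional as Mem
import Data.List.Membership.Propositional.Properties as MemP
open import Data.Product using (Σ; ∃; _×_; _,_; proj₁; proj₂)
open import Data.Sum using ([_,_]′)
open import Data.Unit using (⊤; tt)
open import Data.Empty using (⊥-elim)
open import Function using (_∘_; id)
open import Function.Bundles using (_⇔_; mk⇔; Equivalence)
open import Relation.Nullary using (Dec; yes; no; ¬_)
open import Relation.Nullary.Decidable using (_×-dec_; _→-dec_)
open import Relation.Binary using (tri<; tri≈; tri>)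
open import Relation.Binary.PropositionalEquality

-- `below f x` counts the indices i with f i < x.  For injective f the
-- number below f (f i) is the position of f i in increasing order.
below : ∀ {m} → (Fin m → ℕ) → ℕ → ℕ
below {zero}  f x = 0
below {suc m} f x with f Fin.zero ℕ.<? x
... | yes _ = suc (below (f ∘ Fin.suc) x)
... | no  _ = below (f ∘ Fin.suc) x

below-≤ : ∀ {m} (f : Fin m → ℕ) x → below f x ≤ m
below-≤ {zero}  f x = z≤n
below-≤ {suc m} f x with f Fin.zero ℕ.<? x
... | yes _ = s≤s (below-≤ (f ∘ Fin.suc) x)
... | no  _ = ℕP.m≤n⇒m≤1+n (below-≤ (f ∘ Fin.suc) x)

below-< : ∀ {m} (f : Fin m → ℕ) x (j : Fin m) → ¬ f j < x → below f x < m
below-< {suc m} f x j fj≮x with f Fin.zero ℕ.<? x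
below-< {suc m} f x Fin.zero    fj≮x | yes f0<x = ⊥-elim (fj≮x f0<x)
below-< {suc m} f x (Fin.suc j) fj≮x | yes _    = s≤s (below-< (f ∘ Fin.suc) x j fj≮x)
... | no _ = s≤s (below-≤ (f ∘ Fin.suc) x)

below-mono : ∀ {m} (f : Fin m → ℕ) {x y} → x ≤ y → below f x ≤ below f y
below-mono {zero}  f x≤y = z≤n
below-mono {suc m} f {x} {y} x≤y with f Fin.zero ℕ.<? x | f Fin.zero ℕ.<? y
... | yes _ | yes _ = s≤s (below-mono (f ∘ Fin.suc) x≤y)
... | yes p | no ¬q = ⊥-elim (¬q (ℕP.<-≤-trans p x≤y))
... | no _  | yes _ = ℕP.m≤n⇒m≤1+n (below-mono (f ∘ Fin.suc) x≤y)
... | no _  | no _  = below-mono (f ∘ Fin.suc) x≤y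

below-strict : ∀ {m} (f : Fin m → ℕ) {x y} → x ≤ y →
               (j : Fin m) → f j < y → ¬ f j < x → below f x < below f y
below-strict {suc m} f {x} {y} x≤y j fj<y fj≮x with f Fin.zero ℕ.<? x | f Fin.zero ℕ.<? y
below-strict {suc m} f x≤y Fin.zero fj<y fj≮x | yes p | _ = ⊥-elim (fj≮x p)
below-strict {suc m} f x≤y Fin.zero fj<y fj≮x | no _ | yes _ = s≤s (below-mono (f ∘ Fin.suc) x≤y)
below-strict {suc m} f x≤y Fin.zero fj<y fj≮x | no _ | no ¬q = ⊥-elim (¬q fj<y)
below-strict {suc m} f x≤y (Fin.suc j) fj<y fj≮x | yes _ | yes _ =
  s≤s (below-strict (f ∘ Fin.suc) x≤y j fj<y fj≮x)
below-strict {suc m} f x≤y (Fin.suc j) fj<y fj≮x | yes p | no ¬q = ⊥-elim (¬q (ℕP.<-≤-trans p x≤y))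
below-strict {suc m} f x≤y (Fin.suc j) fj<y fj≮x | no _ | yes _ =
  ℕP.m≤n⇒m≤1+n (below-strict (f ∘ Fin.suc) x≤y j fj<y fj≮x)
below-strict {suc m} f x≤y (Fin.suc j) fj<y fj≮x | no _ | no _ =
  below-strict (f ∘ Fin.suc) x≤y j fj<y fj≮x

injective⇒surjective : ∀ {n} (h : Fin n → Fin n) → (∀ {i j} → h i ≡ h j → i ≡ j) →
                       ∀ k → ∃ λ i → h i ≡ k
injective⇒surjective {n} h h-inj k with FinP.any? (λ i → h i FinP.≟ k)
... | yes hit = hit
injective⇒surjective {suc n} h h-inj k | no miss = ⊥-elim (FinP.<-irrefl i≡j i<j)
  where
  avoids : ∀ i → k ≢ h i
  avoids i e = miss (i , sym e)
  squeeze : Fin (suc n) → Fin n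
  squeeze i = punchOut (avoids i)
  collision = FinP.pigeonhole (ℕP.n<1+n n) squeeze
  i = proj₁ collision
  j = proj₁ (proj₂ collision)
  i<j = proj₁ (proj₂ (proj₂ collision))
  i≡j : i ≡ j
  i≡j = h-inj (FinP.punchOut-injective (avoids i) (avoids j) (proj₂ (proj₂ (proj₂ collision))))

-- Sorting the points of Fin n by an injective weight f: `rank` is the
-- position in increasing order and `unrank` its inverse, so f ∘ unrank is
-- increasing.
module Sorting {n : ℕ} (f : Fin n → ℕ) (f-inj : ∀ {i j} → f i ≡ f j → i ≡ j) where

  rank : Fin n → Fin n
  rank i = fromℕ< (below-< f (f i) i (ℕP.<-irrefl refl))

  rank-increasing : ∀ i j → f i < f j → toℕ (rank i) < toℕ (rank j)
  rank-increasing i j fi<fj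
    rewrite FinP.toℕ-fromℕ< (below-< f (f i) i (ℕP.<-irrefl refl))
          | FinP.toℕ-fromℕ< (below-< f (f j) j (ℕP.<-irrefl refl))
    = below-strict f (ℕP.<⇒≤ fi<fj) i fi<fj (ℕP.<-irrefl refl)

  rank-injective : ∀ {i j} → rank i ≡ rank j → i ≡ j
  rank-injective {i} {j} e with ℕP.<-cmp (f i) (f j)
  ... | tri< fi<fj _ _ = ⊥-elim (ℕP.<-irrefl (cong toℕ e) (rank-increasing i j fi<fj))
  ... | tri≈ _ fi≡fj _ = f-inj fi≡fj
  ... | tri> _ _ fj<fi = ⊥-elim (ℕP.<-irrefl (cong toℕ (sym e)) (rank-increasing j i fj<fi))

  unrank : Fin n → Fin n
  unrank a = proj₁ (injective⇒surjective rank rank-injective a)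

  rank-unrank : ∀ a → rank (unrank a) ≡ a
  rank-unrank a = proj₂ (injective⇒surjective rank rank-injective a)

  unrank-rank : ∀ i → unrank (rank i) ≡ i
  unrank-rank i = rank-injective (rank-unrank (rank i))

  unrank-increasing : ∀ a b → toℕ a < toℕ b → f (unrank a) < f (unrank b)
  unrank-increasing a b a<b with ℕP.<-cmp (f (unrank a)) (f (unrank b))
  ... | tri< lt _ _ = lt
  ... | tri≈ _ eq _ = ⊥-elim (ℕP.<-irrefl (cong toℕ a≡b) a<b)
    where
    a≡b : a ≡ b
    a≡b = trans (sym (rank-unrank a)) (trans (cong rank (f-inj eq)) (rank-unrank b))
  ... | tri> _ _ gt = ⊥-elim (ℕP.<-asym a<b
      (subst₂ (λ u v → toℕ u < toℕ v) (rank-unrank b) (rank-unrank a) (rank-increasing _ _ gt)))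

allVecs : ∀ n k → List (Vec (Fin n) k)
allVecs n zero    = Vec.[] ∷ []
allVecs n (suc k) = List.cartesianProductWith Vec._∷_ (List.allFin n) (allVecs n k)

allVecs-complete : ∀ n k (v : Vec (Fin n) k) → v Mem.∈ allVecs n k
allVecs-complete n zero    Vec.[]       = here refl
allVecs-complete n (suc k) (x Vec.∷ v) =
  MemP.∈-cartesianProductWith⁺ Vec._∷_ (MemP.∈-allFin x) (allVecs-complete n k v)

module Select {X : Set} (P : X → Set) (P? : ∀ x → Dec (P x)) where

  select : List X → List (Σ X P)
  select []       = []
  select (x ∷ xs) with P? x
  ... | yes p = (x , p) ∷ select xs
  ... | no  _ = select xs

  select-complete : ∀ {x} xs → x Mem.∈ xs → P x → Any (λ y → proj₁ y ≡ x) (select xs)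
  select-complete (y ∷ xs) (here refl) px with P? y
  ... | yes _  = here refl
  ... | no ¬py = ⊥-elim (¬py px)
  select-complete (y ∷ xs) (there x∈xs) px with P? y
  ... | yes _ = there (select-complete xs x∈xs px)
  ... | no  _ = select-complete xs x∈xs px

Table : ℕ → Set
Table n = Vec (Fin n) n

InverseTables : ∀ {n} → Table n × Table n → Set
InverseTables (u , w) = (∀ k → Vec.lookup w (Vec.lookup u k) ≡ k) × (∀ k → Vec.lookup u (Vec.lookup w k) ≡ k)

Reordering : ℕ → Set
Reordering n = Σ (Table n × Table n) InverseTables

inverseTables? : ∀ {n} (t : Table n × Table n) → Dec (InverseTables t)
inverseTables? (u , w) = FinP.all? (λ k → Vec.lookup w (Vec.lookup u k) FinP.≟ k)
                   ×-dec FinP.all? (λ k → Vec.lookup u (Vec.lookup w k) FinP.≟ k)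

reorderings : ∀ n → List (Reordering n)
reorderings n = select (List.cartesianProduct (allVecs n n) (allVecs n n))
  where open Select InverseTables inverseTables?

reorderings-complete : ∀ {n} (t : Table n × Table n) → InverseTables t →
                       Any (λ y → proj₁ y ≡ t) (reorderings n)
reorderings-complete {n} (u , w) =
  select-complete _ (MemP.∈-cartesianProduct⁺ (allVecs-complete n n u) (allVecs-complete n n w))
  where open Select InverseTables inverseTables?

idE : ∀ {L C} {A : Str L C} → Emb A A
idE {A = A} = record { fun = id ; inj = id ; pres = λ s v → cong (rel A s) (VecP.map-id v) }

castE : ∀ {L X Y} {C C' : Str L X} {D : Str L Y} → Emb C D → (∀ s v → rel C' s v ≡ rel C s v) → Emb C' D
castE e eq = record { fun = fun e ; inj = inj e ; pres = λ s v → trans (pres e s v) (sym (eq s v)) }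

ordered-resp : ∀ {L C D} {A : Str L C} {B : Str L D} (ρC : C → ℕ) (ρD : D → ℕ) (f g : Emb A B) →
               (∀ x → fun f x ≡ fun g x) → IsOrdered ρC ρD f → IsOrdered ρC ρD g
ordered-resp ρC ρD f g f≗g f-ord x y lt = subst₂ (λ a b → ρD a < ρD b) (f≗g x) (f≗g y) (f-ord x y lt)

idO : ∀ {L} {K : Str L ℕ} → OEmbK K
idO = idE , λ x y lt → lt

_∘OK_ : ∀ {L} {K : Str L ℕ} → OEmbK K → OEmbK K → OEmbK K
(η , η-ord) ∘OK (θ , θ-ord) = η ∘E θ , λ x y lt → η-ord _ _ (θ-ord x y lt)

Confined : ∀ {L} {B : FinStr L} {K : Str L ℕ} {r ℓ} →
           (OEmbF B K → Fin r) → OEmbK K → (Fin ℓ → Fin r) → Set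
Confined χ η cs = ∀ g → ∃ λ k → χ (η ∘O g) ≡ cs k

module _ {L} {B : FinStr L} {K : Str L ℕ} {r : ℕ} (χ : OEmbF B K → Fin r) (χ-ext : Extensional proj₁ χ) where

  confined-∘ : ∀ {ℓ} (η θ : OEmbK K) {cs : Fin ℓ → Fin r} →
               Confined (λ g → χ (η ∘O g)) θ cs → Confined χ (η ∘OK θ) cs
  confined-∘ η θ conf g = proj₁ (conf g) , trans (χ-ext _ _ λ x → refl) (proj₂ (conf g))

  confined-post : ∀ {ℓ} (η θ : OEmbK K) {cs : Fin ℓ → Fin r} →
                  Confined χ η cs → Confined χ (η ∘OK θ) cs
  confined-post η θ conf g = proj₁ (conf (θ ∘O g)) , trans (χ-ext _ _ λ x → refl) (proj₂ (conf (θ ∘O g)))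

confined-relabel : ∀ {L} {B : FinStr L} {K : Str L ℕ} {r ℓ ℓ'} {χ : OEmbF B K → Fin r} {η : OEmbK K}
                   {cs : Fin ℓ → Fin r} {cs' : Fin ℓ' → Fin r} (m : Fin ℓ → Fin ℓ') →
                   (∀ k → cs' (m k) ≡ cs k) → Confined χ η cs → Confined χ η cs'
confined-relabel m same conf g = m (proj₁ (conf g)) , trans (proj₂ (conf g)) (sym (same _))

_⊕_ : ∀ {a b} {X : Set} → (Fin a → X) → (Fin b → X) → Fin (a + b) → X
_⊕_ {a} p q k = [ p , q ]′ (splitAt a k)

⊕-left : ∀ {a b} {X : Set} (p : Fin a → X) (q : Fin b → X) k → (p ⊕ q) (k ↑ˡ b) ≡ p k
⊕-left {a} {b} p q k = cong [ p , q ]′ (FinP.splitAt-↑ˡ a k b)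

⊕-right : ∀ {a b} {X : Set} (p : Fin a → X) (q : Fin b → X) k → (p ⊕ q) (a ↑ʳ k) ≡ q k
⊕-right {a} {b} p q k = cong [ p , q ]′ (FinP.splitAt-↑ʳ a b k)

-- Induction on the
-- list: first handle the tail, then apply the bound for the head to the
-- colouring transported along the tail's η.
simultaneous : ∀ {L} {K : Str L ℕ} {I : Set} (B : I → FinStr L) (ℓ : I → ℕ) →
               (∀ i → OrderedRamseyBound (B i) K (ℓ i)) →
               (r : ℕ) (χ : (i : I) → OEmbF (B i) K → Fin r) → (∀ i → Extensional proj₁ (χ i)) →
               (is : List I) →
               Σ (OEmbK K) λ η → Σ (Fin (sum (List.map ℓ is)) → Fin r) λ cs →
                 All (λ i → Confined (χ i) η cs) is
simultaneous B ℓ bound r χ χ-ext [] = idO , (λ ()) , []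
simultaneous B ℓ bound r χ χ-ext (i ∷ is) with simultaneous B ℓ bound r χ χ-ext is
... | η , cs , conf with bound i r (λ g → χ i (η ∘O g)) (λ f g f≗g → χ-ext i _ _ (λ x → cong (fun (proj₁ η)) (f≗g x)))
... | θ , csᵢ , confᵢ =
  η ∘OK θ , csᵢ ⊕ cs ,
  confined-relabel {χ = χ i} {η = η ∘OK θ} (_↑ˡ _) (⊕-left csᵢ cs)
    (confined-∘ (χ i) (χ-ext i) η θ confᵢ)
  ∷ All.map (λ {j} c → confined-relabel {χ = χ j} {η = η ∘OK θ} (ℓ i ↑ʳ_) (⊕-right csᵢ cs)
                         (confined-post (χ j) (χ-ext j) η θ c)) conf

module Forward {L : Lang} (𝒦 : Class L) (K : Str L ℕ) (F : IsFraisseClass 𝒦)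
               (H : AllFiniteOrderedDegrees 𝒦 K) {n : ℕ} (SA : Str L (Fin n)) (A∈𝒦 : 𝒦 (n , SA)) where
  open IsFraisseClass F

  reordered : Table n → Str L (Fin n)
  reordered u = mkStr λ s v → rel SA s (Vec.map (Vec.lookup u) v)

  Reordered : Reordering n → FinStr L
  Reordered y = n , reordered (proj₁ (proj₁ y))

  reorder : (y : Reordering n) → Emb (reordered (proj₁ (proj₁ y))) SA
  reorder ((u , w) , wu≡id , uw≡id) = record
    { fun  = Vec.lookup u
    ; inj  = λ {i} {j} e → trans (sym (wu≡id i)) (trans (cong (Vec.lookup w) e) (wu≡id j))
    ; pres = λ s v → refl }

  unreorder : (y : Reordering n) → Emb SA (reordered (proj₁ (proj₁ y)))
  unreorder ((u , w) , wu≡id , uw≡id) = record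
    { fun  = Vec.lookup w
    ; inj  = λ {i} {j} e → trans (sym (uw≡id i)) (trans (cong (Vec.lookup u) e) (uw≡id j))
    ; pres = λ s v → cong (rel SA s) (trans (sym (VecP.map-∘ (Vec.lookup u) (Vec.lookup w) v))
                                            (trans (VecP.map-cong uw≡id v) (VecP.map-id v))) }

  reorder-unreorder : (y : Reordering n) (x : Fin n) → fun (reorder y) (fun (unreorder y) x) ≡ x
  reorder-unreorder ((u , w) , wu≡id , uw≡id) = uw≡id

  Reordered∈𝒦 : (y : Reordering n) → 𝒦 (Reordered y)
  Reordered∈𝒦 y = hereditary (Reordered y) (n , SA) (reorder y) A∈𝒦

  -- every embedding of A becomes ordered on one of the listed reorderings:
  -- the one sorting A by the images of its points
  sortingReordering : (f : Emb SA K) →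
                      Any (λ y → IsOrdered toℕ id (f ∘E reorder y)) (reorderings n)
  sortingReordering f = Any.map (λ {y} → sorts {y}) (reorderings-complete (u , w) inverse)
    where
    open Sorting (fun f) (inj f)
    u w : Table n
    u = Vec.tabulate unrank
    w = Vec.tabulate rank
    inverse : InverseTables (u , w)
    inverse = (λ k → trans (cong (Vec.lookup w) (VecP.lookup∘tabulate unrank k))
                           (trans (VecP.lookup∘tabulate rank (unrank k)) (rank-unrank k)))
            , (λ k → trans (cong (Vec.lookup u) (VecP.lookup∘tabulate rank k))
                           (trans (VecP.lookup∘tabulate unrank (rank k)) (unrank-rank k)))
    sorts : ∀ {y} → proj₁ y ≡ (u , w) → IsOrdered toℕ id (f ∘E reorder y)
    sorts {(.u , .w) , _} refl a b a<b =
      subst₂ (λ x y → fun f x < fun f y) (sym (VecP.lookup∘tabulate unrank a))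
             (sym (VecP.lookup∘tabulate unrank b)) (unrank-increasing a b a<b)

  ℓ : Reordering n → ℕ
  ℓ y = proj₁ (H (Reordered y) (Reordered∈𝒦 y))

  -- Colour the ordered copies of each reordering by the colour of the
  -- corresponding embedding of A and confine all of them simultaneously.
  bigRamseyBound : RamseyBound (n , SA) K (sum (List.map ℓ (reorderings n)))
  bigRamseyBound r χ χ-ext = proj₁ η , cs , colourOf
    where
    χ′ : (y : Reordering n) → OEmbF (Reordered y) K → Fin r
    χ′ y g = χ (proj₁ g ∘E unreorder y)
    joint = simultaneous Reordered ℓ (λ y → proj₂ (H (Reordered y) (Reordered∈𝒦 y))) r χ′
              (λ y g h g≗h → χ-ext _ _ (λ x → g≗h (fun (unreorder y) x))) (reorderings n)
    η = proj₁ joint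
    cs = proj₁ (proj₂ joint)
    colourOf : ∀ (f : Emb SA K) → ∃ λ k → χ (proj₁ η ∘E f) ≡ cs k
    colourOf f = proj₁ (conf g) , trans (χ-ext _ _ f≗g∘unreorder) (proj₂ (conf g))
      where
      y = Any.lookup (sortingReordering f)
      found = All.lookupAny (proj₂ (proj₂ joint)) (sortingReordering f)
      conf : Confined (χ′ y) η cs
      conf = proj₁ found
      g : OEmbF (Reordered y) K
      g = f ∘E reorder y , proj₂ found
      f≗g∘unreorder : ∀ x → fun (proj₁ η) (fun f x) ≡ fun (proj₁ η) (fun f (fun (reorder y) (fun (unreorder y) x)))
      f≗g∘unreorder x = cong (fun (proj₁ η) ∘ fun f) (sym (reorder-unreorder y x))

forward : ∀ {L} (𝒦 : Class L) (K : Str L ℕ) → IsFraisseClass 𝒦 →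
          AllFiniteOrderedDegrees 𝒦 K → HasFiniteBigRamseyDegrees 𝒦 K
forward 𝒦 K F H (n , SA) A∈𝒦 = _ , bigRamseyBound
  where open Forward 𝒦 K F H SA A∈𝒦

-- The largest entry of a vector, and the vector recoded over Fin of a
-- bound above all its entries (to view a tuple of K inside a prefix).
vmax : ∀ {k} → Vec ℕ k → ℕ
vmax Vec.[]       = 0
vmax (x Vec.∷ v) = x ⊔ vmax v

vmax-≥ : ∀ {k} (v : Vec ℕ k) i → Vec.lookup v i ≤ vmax v
vmax-≥ (x Vec.∷ v) Fin.zero    = ℕP.m≤m⊔n x (vmax v)
vmax-≥ (x Vec.∷ v) (Fin.suc i) = ℕP.≤-trans (vmax-≥ v i) (ℕP.m≤n⊔m x (vmax v))

recode : ∀ {k} (v : Vec ℕ k) → Vec (Fin (suc (vmax v))) k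
recode v = Vec.tabulate λ i → fromℕ< (s≤s (vmax-≥ v i))

recode-toℕ : ∀ {k} (v : Vec ℕ k) → Vec.map toℕ (recode v) ≡ v
recode-toℕ v = begin
  Vec.map toℕ (recode v)               ≡⟨ VecP.tabulate-∘ toℕ _ ⟨
  Vec.tabulate (toℕ ∘ (λ i → fromℕ< _)) ≡⟨ VecP.tabulate-cong (λ i → FinP.toℕ-fromℕ< _) ⟩
  Vec.tabulate (Vec.lookup v)          ≡⟨ VecP.tabulate∘lookup v ⟩
  v                                    ∎
  where open ≡-Reasoning

maxOf : ∀ {m} → (Fin m → ℕ) → ℕ
maxOf g = vmax (Vec.tabulate g)

maxOf-≥ : ∀ {m} (g : Fin m → ℕ) i → g i ≤ maxOf g
maxOf-≥ g i = subst (_≤ maxOf g) (VecP.lookup∘tabulate g i) (vmax-≥ (Vec.tabulate g) i)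

lastCases : ∀ {m} (P : Fin (suc m) → Set) → P (fromℕ m) → (∀ j → P (inject₁ j)) → ∀ i → P i
lastCases P last earlier = >-weakInduction P last (λ j _ → earlier j)

restrict : ∀ {L m} → Str L (Fin (suc m)) → Str L (Fin m)
restrict C = mkStr λ s v → rel C s (Vec.map inject₁ v)

restrictionEmb : ∀ {L m} (C : Str L (Fin (suc m))) → Emb (restrict C) C
restrictionEmb C = record { fun = inject₁ ; inj = FinP.inject₁-injective ; pres = λ s v → refl }

Extends : ∀ {m} {X : Set} → (Fin (suc m) → X) → (Fin m → X) → Set
Extends e t = ∀ i → e (inject₁ i) ≡ t i

DistinctLast : ∀ {m N} {X : Set} → (Fin (suc N) → Fin (suc m) → X) → Set
DistinctLast {m} o = ∀ j j' → o j (fromℕ m) ≡ o j' (fromℕ m) → j ≡ j'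

prefix : ∀ {L} → Str L ℕ → (m : ℕ) → Str L (Fin m)
prefix K m = mkStr λ s v → rel K s (Vec.map toℕ v)

prefixEmb : ∀ {L} (K : Str L ℕ) m → Emb (prefix K m) K
prefixEmb K m = record { fun = toℕ ; inj = FinP.toℕ-injective ; pres = λ s v → refl }

initialSegment : ∀ {L n} → Str L (Fin n) → (k : ℕ) → k ≤ n → Str L (Fin k)
initialSegment SA k k≤n = mkStr λ s v → rel SA s (Vec.map (λ i → Fin.inject≤ i k≤n) v)

initialSegmentEmb : ∀ {L n} (SA : Str L (Fin n)) k (k≤n : k ≤ n) → Emb (initialSegment SA k k≤n) SA
initialSegmentEmb SA k k≤n = record
  { fun = λ i → Fin.inject≤ i k≤n ; inj = λ {i} {j} → FinP.inject≤-injective k≤n k≤n i j ; pres = λ s v → refl }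

module Backward {L : Lang} (𝒦 : Class L) (K : Str L ℕ) (S : IsStrongAmalgamationClass 𝒦) (FL : IsFlim 𝒦 K) where
  open IsFraisseClass (proj₁ S)

  toK : ∀ A → 𝒦 A → Emb (str A) K
  toK A = Equivalence.to (proj₁ FL A)

  fromK : ∀ A → Emb (str A) K → 𝒦 A
  fromK A = Equivalence.from (proj₁ FL A)

  module OnePointExtension {m : ℕ} (C : Str L (Fin (suc m))) (C∈𝒦 : 𝒦 (suc m , C)) where

    restriction∈𝒦 : 𝒦 (m , restrict C)
    restriction∈𝒦 = hereditary (m , restrict C) (suc m , C) (restrictionEmb C) C∈𝒦

    -- Induction on N: strongly
    -- amalgamate D with a fresh copy of C over the restriction; strongness
    -- keeps the new last point away from the old ones.
    copiesIn𝒦 : ∀ N → Σ (FinStr L) λ D → 𝒦 D × Σ (Fin (suc N) → Emb C (str D)) λ a →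
                  (∀ j → Extends (fun (a j)) (fun (a Fin.zero) ∘ inject₁)) × DistinctLast (fun ∘ a)
    copiesIn𝒦 zero = (suc m , C) , C∈𝒦 , (λ _ → idE) , (λ { Fin.zero x → refl }) , λ { Fin.zero Fin.zero _ → refl }
    copiesIn𝒦 (suc N) with copiesIn𝒦 N
    ... | D , D∈𝒦 , a , agree , distinct
        with proj₂ S (m , restrict C) D (suc m , C) (a Fin.zero ∘E restrictionEmb C) (restrictionEmb C)
                     restriction∈𝒦 D∈𝒦 C∈𝒦
    ... | D' , D'∈𝒦 , r , s , commute , _ , intersection = D' , D'∈𝒦 , a' , agree' , distinct'
      where
      a' : Fin (suc (suc N)) → Emb C (str D')
      a' Fin.zero    = s
      a' (Fin.suc j) = r ∘E a j
      agree' : ∀ j → Extends (fun (a' j)) (fun (a' Fin.zero) ∘ inject₁)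
      agree' Fin.zero    x = refl
      agree' (Fin.suc j) x = trans (cong (fun r) (agree j x)) (commute x)
      -- a common point of im r and im s comes from the restriction, so it is not a last point
      fresh : ∀ j → fun s (fromℕ m) ≢ fun r (fun (a j) (fromℕ m))
      fresh j e with intersection (fun (a j) (fromℕ m)) (fromℕ m) (sym e)
      ... | x , e' = FinP.fromℕ≢inject₁ (sym (inj (a j) (trans (agree j x) (inj r e'))))
      distinct' : DistinctLast (fun ∘ a')
      distinct' Fin.zero    Fin.zero     e = refl
      distinct' Fin.zero    (Fin.suc j') e = ⊥-elim (fresh j' e)
      distinct' (Fin.suc j) Fin.zero     e = ⊥-elim (fresh j (sym e))
      distinct' (Fin.suc j) (Fin.suc j') e = cong Fin.suc (distinct j j' (inj r e))

    -- the copies moved into K over a given embedding τ of the restriction,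
    -- using ultrahomogeneity
    copiesInK : (τ : Emb (restrict C) K) (N : ℕ) → Σ (Fin (suc N) → Emb C K) λ o →
                (∀ j → Extends (fun (o j)) (fun τ)) × DistinctLast (fun ∘ o)
    copiesInK τ N with copiesIn𝒦 N
    ... | D , D∈𝒦 , a , agree , distinct = o , extends , λ j j' e → distinct j j' (inj e₀ (inj σ e))
      where
      e₀ = toK D D∈𝒦
      move = proj₂ FL (m , restrict C) ((e₀ ∘E a Fin.zero) ∘E restrictionEmb C) τ
      σ = proj₁ (proj₁ move)
      o : Fin (suc N) → Emb C K
      o j = σ ∘E (e₀ ∘E a j)
      extends : ∀ j → Extends (fun (o j)) (fun τ)
      extends j x = trans (cong (fun σ ∘ fun e₀) (agree j x)) (proj₂ move x)

    -- Among B+2 extensions with distinct last points, an injective h sends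
    -- some last point above B (pigeonhole on the values 0 … B).
    farExtension : (τ : Emb (restrict C) K) (h : ℕ → ℕ) → (∀ {x y} → h x ≡ h y → x ≡ y) → (B : ℕ) →
                   Σ (Emb C K) λ e → Extends (fun e) (fun τ) × B < h (fun e (fromℕ m))
    farExtension τ h h-inj B with copiesInK τ (suc B)
    ... | o , extends , distinct with FinP.any? (λ j → B ℕ.<? h (fun (o j) (fromℕ m)))
    ... | yes (j , far) = o j , extends j , far
    ... | no none = ⊥-elim (FinP.<-irrefl (distinct i j (h-inj same)) i<j)
      where
      value : Fin (suc (suc B)) → Fin (suc B)
      value j = fromℕ< (s≤s (ℕP.≮⇒≥ (λ far → none (j , far))))
      collision = FinP.pigeonhole (ℕP.n<1+n (suc B)) value
      i = proj₁ collision
      j = proj₁ (proj₂ collision)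
      i<j = proj₁ (proj₂ (proj₂ collision))
      same : h (fun (o i) (fromℕ m)) ≡ h (fun (o j) (fromℕ m))
      same = trans (sym (FinP.toℕ-fromℕ< _))
                   (trans (cong toℕ (proj₂ (proj₂ (proj₂ collision)))) (FinP.toℕ-fromℕ< _))

  -- A chain C 0 ⊆ C 1 ⊆ … of structures in 𝒦 (each the restriction of the
  -- next; Ok cuts out an initial segment of ℕ) embeds into K coherently so
  -- that a given injective h increases along the embedded points: each new
  -- point is chosen above all earlier h-values by farExtension.
  module IncreasingChain (Ok : ℕ → Set) (down : ∀ {m} → Ok (suc m) → Ok m)
    (C : (m : ℕ) → Ok m → Str L (Fin m)) (C∈𝒦 : ∀ m p → 𝒦 (m , C m p))
    (coherent : ∀ m (p : Ok (suc m)) s v → rel (restrict (C (suc m) p)) s v ≡ rel (C m (down p)) s v)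
    (h : ℕ → ℕ) (h-inj : ∀ {x y} → h x ≡ h y → x ≡ y) where

    chainEmb : ∀ m p → Emb (C m p) K
    chainStep : ∀ m (p : Ok (suc m)) → Σ (Emb (C (suc m) p) K) λ e →
                Extends (fun e) (fun (chainEmb m (down p))) ×
                maxOf (h ∘ fun (chainEmb m (down p))) < h (fun e (fromℕ m))
    chainEmb zero    p = toK (0 , C 0 p) (C∈𝒦 0 p)
    chainEmb (suc m) p = proj₁ (chainStep m p)
    chainStep m p = OnePointExtension.farExtension (C (suc m) p) (C∈𝒦 (suc m) p)
                      (castE (chainEmb m (down p)) (coherent m p)) h h-inj (maxOf (h ∘ fun (chainEmb m (down p))))

    chain-extends : ∀ m p → Extends (fun (chainEmb (suc m) p)) (fun (chainEmb m (down p)))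
    chain-extends m p = proj₁ (proj₂ (chainStep m p))

    chain-increasing : ∀ m p (i j : Fin m) → toℕ i < toℕ j → h (fun (chainEmb m p) i) < h (fun (chainEmb m p) j)
    chain-increasing (suc m) p = lastCases _ lastIsLargest (λ i → lastCases _ (belowLast i) (earlier i))
      where
      e = fun (chainEmb (suc m) p)
      lastIsLargest : ∀ j → toℕ (fromℕ m) < toℕ j → h (e (fromℕ m)) < h (e j)
      lastIsLargest j lt = ⊥-elim (ℕP.<-irrefl refl
        (ℕP.<-≤-trans (subst (_< toℕ j) (FinP.toℕ-fromℕ m) lt) (ℕP.≤-pred (FinP.toℕ<n j))))
      belowLast : ∀ i → toℕ (inject₁ i) < toℕ (fromℕ m) → h (e (inject₁ i)) < h (e (fromℕ m))
      belowLast i _ = subst (λ z → h z < h (e (fromℕ m))) (sym (chain-extends m p i))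
        (ℕP.≤-<-trans (maxOf-≥ (h ∘ fun (chainEmb m (down p))) i) (proj₂ (proj₂ (chainStep m p))))
      earlier : ∀ i j → toℕ (inject₁ i) < toℕ (inject₁ j) → h (e (inject₁ i)) < h (e (inject₁ j))
      earlier i j lt = subst₂ (λ a b → h a < h b) (sym (chain-extends m p i)) (sym (chain-extends m p j))
        (chain-increasing m (down p) i j (subst₂ _<_ (FinP.toℕ-inject₁ i) (FinP.toℕ-inject₁ j) lt))

  -- Every A ∈ 𝒦 has an ordered embedding into K: embed its initial segments
  -- increasingly.
  orderedEmbedding : ∀ {n} (SA : Str L (Fin n)) → 𝒦 (n , SA) → OEmbF (n , SA) K
  orderedEmbedding {n} SA A∈𝒦 = castE (chainEmb n ℕP.≤-refl) whole , chain-increasing n ℕP.≤-refl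
    where
    segment∈𝒦 : ∀ k k≤n → 𝒦 (k , initialSegment SA k k≤n)
    segment∈𝒦 k k≤n = hereditary _ _ (initialSegmentEmb SA k k≤n) A∈𝒦
    coherent : ∀ k (p : suc k ≤ n) s v →
               rel (restrict (initialSegment SA (suc k) p)) s v ≡ rel (initialSegment SA k (ℕP.<⇒≤ p)) s v
    coherent k p s v = cong (rel SA s) (trans (sym (VecP.map-∘ _ inject₁ v)) (VecP.map-cong
      (λ i → FinP.toℕ-injective (trans (FinP.toℕ-inject≤ (inject₁ i) p)
                                 (trans (FinP.toℕ-inject₁ i) (sym (FinP.toℕ-inject≤ i (ℕP.<⇒≤ p)))))) v))
    open IncreasingChain (_≤ n) ℕP.<⇒≤ (initialSegment SA) segment∈𝒦 coherent id id
    whole : ∀ s v → rel SA s v ≡ rel (initialSegment SA n ℕP.≤-refl) s v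
    whole s v = cong (rel SA s) (sym (trans
      (VecP.map-cong (λ i → FinP.toℕ-injective (FinP.toℕ-inject≤ i ℕP.≤-refl)) v) (VecP.map-id v)))

  -- For every η : K → K there is θ : K → K with η ∘ θ increasing: embed the
  -- prefixes of K so that η increases along them; θ n is the image of n.
  module Straighten (η : Emb K K) where
    prefix∈𝒦 : ∀ m (_ : ⊤) → 𝒦 (m , prefix K m)
    prefix∈𝒦 m _ = fromK (m , prefix K m) (prefixEmb K m)
    coherent : ∀ m (_ : ⊤) s v → rel (restrict (prefix K (suc m))) s v ≡ rel (prefix K m) s v
    coherent m _ s v = cong (rel K s) (trans (sym (VecP.map-∘ toℕ inject₁ v)) (VecP.map-cong FinP.toℕ-inject₁ v))
    open IncreasingChain (λ _ → ⊤) (λ _ → tt) (λ m _ → prefix K m) prefix∈𝒦 coherent (fun η) (inj η)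

    θ : ℕ → ℕ
    θ n = fun (chainEmb (suc n) tt) (fromℕ n)

    chain≗θ : ∀ m (i : Fin m) → fun (chainEmb m tt) i ≡ θ (toℕ i)
    chain≗θ (suc m) = lastCases _ (cong θ (sym (FinP.toℕ-fromℕ m)))
      (λ j → trans (chain-extends m tt j) (trans (chain≗θ m j) (cong θ (sym (FinP.toℕ-inject₁ j)))))

    chain-at : ∀ {m c} (c<m : c < m) → fun (chainEmb m tt) (fromℕ< c<m) ≡ θ c
    chain-at c<m = trans (chain≗θ _ _) (cong θ (FinP.toℕ-fromℕ< c<m))

    -- a and b both live in the prefix of length suc (a ⊔ b)
    θ-injective : ∀ {a b} → θ a ≡ θ b → a ≡ b
    θ-injective {a} {b} e = trans (sym (FinP.toℕ-fromℕ< a<M)) (trans (cong toℕ same) (FinP.toℕ-fromℕ< b<M))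
      where
      a<M : a < suc (a ⊔ b)
      a<M = s≤s (ℕP.m≤m⊔n a b)
      b<M : b < suc (a ⊔ b)
      b<M = s≤s (ℕP.m≤n⊔m a b)
      same : fromℕ< a<M ≡ fromℕ< b<M
      same = inj (chainEmb (suc (a ⊔ b)) tt) (trans (chain-at a<M) (trans e (sym (chain-at b<M))))

    -- the entries of v live in a prefix, on which θ is an embedding
    θ-preserves : ∀ s v → rel K s (Vec.map θ v) ≡ rel K s v
    θ-preserves s v = subst (λ v' → rel K s (Vec.map θ v') ≡ rel K s v') (recode-toℕ v) (begin
      rel K s (Vec.map θ (Vec.map toℕ w))     ≡⟨ cong (rel K s) (VecP.map-∘ θ toℕ w) ⟨
      rel K s (Vec.map (θ ∘ toℕ) w)           ≡⟨ cong (rel K s) (VecP.map-cong (λ i → sym (chain≗θ _ i)) w) ⟩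
      rel K s (Vec.map (fun (chainEmb _ tt)) w) ≡⟨ pres (chainEmb _ tt) s w ⟩
      rel K s (Vec.map toℕ w)                 ∎)
      where
      open ≡-Reasoning
      w = recode v

    θE : Emb K K
    θE = record { fun = θ ; inj = θ-injective ; pres = θ-preserves }

    straight : IsOrdered id id (η ∘E θE)
    straight a b a<b = subst (λ x → fun η x < fun η (θ b)) (chain-at a<1+b)
                         (chain-increasing (suc b) tt (fromℕ< a<1+b) (fromℕ b) order)
      where
      a<1+b : a < suc b
      a<1+b = ℕP.m≤n⇒m≤1+n a<b
      order : toℕ (fromℕ< a<1+b) < toℕ (fromℕ b)
      order = subst₂ _<_ (sym (FinP.toℕ-fromℕ< a<1+b)) (sym (FinP.toℕ-fromℕ b)) a<b

  module ExtendedColouring {n} (SA : Str L (Fin n)) {r} (χ : OEmbF (n , SA) K → Fin r)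
                           (χ-ext : Extensional proj₁ χ) where

    ordered? : (f : Emb SA K) → Dec (IsOrdered toℕ id f)
    ordered? f = FinP.all? λ x → FinP.all? λ y → (toℕ x ℕ.<? toℕ y) →-dec (fun f x ℕ.<? fun f y)

    colourBy : (f : Emb SA K) → Dec (IsOrdered toℕ id f) → Fin (suc r)
    colourBy f (yes f-ord) = Fin.suc (χ (f , f-ord))
    colourBy f (no _)      = Fin.zero

    extended : Emb SA K → Fin (suc r)
    extended f = colourBy f (ordered? f)

    colourBy-ext : ∀ f g → (∀ x → fun f x ≡ fun g x) → ∀ df dg → colourBy f df ≡ colourBy g dg
    colourBy-ext f g f≗g (yes f-ord) (yes g-ord) = cong Fin.suc (χ-ext (f , f-ord) (g , g-ord) f≗g)
    colourBy-ext f g f≗g (yes f-ord) (no g-unord) = ⊥-elim (g-unord (ordered-resp toℕ id f g f≗g f-ord))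
    colourBy-ext f g f≗g (no f-unord) (yes g-ord) = ⊥-elim (f-unord (ordered-resp toℕ id g f (sym ∘ f≗g) g-ord))
    colourBy-ext f g f≗g (no _)       (no _)      = refl

    extended-ext : Extensional id extended
    extended-ext f g f≗g = colourBy-ext f g f≗g _ _

    extended-ordered : ∀ f (f-ord : IsOrdered toℕ id f) → extended f ≡ Fin.suc (χ (f , f-ord))
    extended-ordered f f-ord = colourBy-ext f f (λ x → refl) (ordered? f) (yes f-ord)

  -- A big Ramsey bound ℓ for A ∈ 𝒦 is an ordered one: apply it to the
  -- extended colouring, straighten the resulting η, and read the extra
  -- colour as the colour of some fixed ordered copy of A.
  orderedBound : ∀ {n} (SA : Str L (Fin n)) → 𝒦 (n , SA) → ∀ ℓ →
                 RamseyBound (n , SA) K ℓ → OrderedRamseyBound (n , SA) K ℓ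
  orderedBound SA A∈𝒦 ℓ big r χ χ-ext = (η ∘E θE , straight) , lower ∘ cs , colourOf θE straight
    where
    open ExtendedColouring SA χ χ-ext
    result = big (suc r) extended extended-ext
    η = proj₁ result
    cs = proj₁ (proj₂ result)
    open Straighten η
    lower : Fin (suc r) → Fin r
    lower Fin.zero    = χ (orderedEmbedding SA A∈𝒦)
    lower (Fin.suc c) = c
    -- stated for an arbitrary θ, so that the construction of θE is never unfolded
    colourOf : (θ : Emb K K) (ηθ-ord : IsOrdered id id (η ∘E θ)) →
               ∀ (g : OEmbF (_ , SA) K) → ∃ λ k → χ ((η ∘E θ , ηθ-ord) ∘O g) ≡ lower (cs k)
    colourOf θ ηθ-ord g = k , (begin
      χ ((η ∘E θ , ηθ-ord) ∘O g)   ≡⟨ χ-ext _ (f , f-ord) (λ x → refl) ⟩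
      χ (f , f-ord)                ≡⟨ cong lower (extended-ordered f f-ord) ⟨
      lower (extended f)           ≡⟨ cong lower hit ⟩
      lower (cs k)                 ∎)
      where
      open ≡-Reasoning
      f = η ∘E (θ ∘E proj₁ g)
      f-ord : IsOrdered toℕ id f
      f-ord = ordered-resp toℕ id ((η ∘E θ) ∘E proj₁ g) f (λ x → refl) (proj₂ ((η ∘E θ , ηθ-ord) ∘O g))
      k = proj₁ (proj₂ (proj₂ result) (θ ∘E proj₁ g))
      hit : extended f ≡ cs k
      hit = proj₂ (proj₂ (proj₂ result) (θ ∘E proj₁ g))

  backward : HasFiniteBigRamseyDegrees 𝒦 K → AllFiniteOrderedDegrees 𝒦 K
  backward big (n , SA) A∈𝒦 = ℓ , orderedBound SA A∈𝒦 ℓ bound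
    where
    ℓ = proj₁ (big (n , SA) A∈𝒦)
    bound = proj₂ (big (n , SA) A∈𝒦)

proposition1p3 : (L : Lang) (𝒦 : Class L) (K : Str L ℕ) →
    IsFraisseClass 𝒦 → IsFlim 𝒦 K →
    (AllFiniteOrderedDegrees 𝒦 K → HasFiniteBigRamseyDegrees 𝒦 K) ×
    (IsStrongAmalgamationClass 𝒦 →
    (HasFiniteBigRamseyDegrees 𝒦 K ⇔ AllFiniteOrderedDegrees 𝒦 K))
proposition1p3 L 𝒦 K F FL =
  forward 𝒦 K F ,
  λ S → mk⇔ (Backward.backward 𝒦 K S FL) (forward 𝒦 K (proj₁ S))
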